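{- Let $G=(V,E)$ be a connected interval graph and $t\in V$. Then $t$ is the last vertex of some DFS ordering of $G$ if and only if the induced subgraph $G[N(t)]$ contains a hamiltonian path.
   Context: An interval graph is the intersection graph of a family of intervals on the real line. $N(t)$ is the set of neighbours of $t$. A DFS ordering is an ordering obtained by starting at an arbitrary vertex and, at each step, visiting next an unvisited neighbour of the most recently visited vertex that still has an unvisited neighbour (backtracking as needed), with arbitrary tie-breaks. -}

module Defs where

open import Level using (0ℓ)
open import Data.Nat using (ℕ; suc; _≤_)
open import Data.Fin using (Fin; _<_; fromℕ)
open import Data.Product using (Σ; ∃; ∃-syntax; Σ-syntax; _×_)
open import Data.List using (List)
open import Data.List.Membership.Propositional using (_∈_)
open import Data.List.Relation.Unary.Unique.Propositional using (Unique)
open import Data.List.Relation.Unary.Linked using (Linked)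
open import Relation.Binary.PropositionalEquality using (_≡_; _≢_)
open import Relation.Binary.Construct.Closure.ReflexiveTransitive using (Star)
open import Relation.Nullary using (¬_)
open import Function.Definitions using (Injective)
open import Function.Bundles using (_⇔_)

record Graph (n : ℕ) : Set₁ where
  field
    Adj    : Fin n → Fin n → Set
    sym    : ∀ {u v} → Adj u v → Adj v u
    irrefl : ∀ {u} → ¬ Adj u u
open Graph public

Connected : ∀ {n} → Graph n → Set
Connected {n} G = ∀ (u v : Fin n) → Star (Adj G) u v

-- Interval graph: intersection graph of a family of closed intervals [l v, r v].
-- (Endpoints in ℕ; for finite families this is equivalent to real endpoints.)
IsIntervalGraph : ∀ {n} → Graph n → Set
IsIntervalGraph {n} G =
  Σ (Fin n → ℕ) λ l → Σ (Fin n → ℕ) λ r →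
    ((∀ (v : Fin n) → l v ≤ r v) ×
     (∀ (u v : Fin n) → u ≢ v → (Adj G u v ⇔ (l u ≤ r v × l v ≤ r u))))

-- σ : positions → vertices, a vertex ordering (σ i is the i-th visited vertex).
IsOrdering : ∀ {n} → (Fin n → Fin n) → Set
IsOrdering σ = Injective _≡_ _≡_ σ

VisitedBefore : ∀ {n} → (Fin n → Fin n) → Fin n → Fin n → Set
VisitedBefore {n} σ i w = Σ[ m ∈ Fin n ] (m < i × σ m ≡ w)

-- DFS ordering: every vertex after the first is a neighbour of the most recently
-- visited vertex that still has an unvisited neighbour: σ i is adjacent to σ j
-- with j < i, and every σ k with j < k < i has no unvisited neighbour.
IsDFSOrdering : ∀ {n} → Graph n → (Fin n → Fin n) → Set
IsDFSOrdering {n} G σ =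
  IsOrdering σ ×
  (∀ (i : Fin n) → (Σ[ m ∈ Fin n ] (m < i)) →
     Σ[ j ∈ Fin n ] (j < i × Adj G (σ j) (σ i) ×
       (∀ (k : Fin n) → j < k → k < i →
          ∀ (w : Fin n) → Adj G (σ k) w → VisitedBefore σ i w)))

IsDFSEndVertex : ∀ {n} → Graph (suc n) → Fin (suc n) → Set
IsDFSEndVertex {n} G t = Σ[ σ ∈ (Fin (suc n) → Fin (suc n)) ] (IsDFSOrdering G σ × σ (fromℕ n) ≡ t)

HasHamPathInNbhd : ∀ {n} → Graph n → Fin n → Set
HasHamPathInNbhd {n} G t =
  Σ[ p ∈ List (Fin n) ] (Unique p × (∀ (v : Fin n) → (v ∈ p ⇔ Adj G t v)) × Linked (Adj G) p)

{-# OPTIONS --safe #-}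
-- (⇒) List N(t) in the order of a DFS ordering σ ending at t.  For consecutive entries a, b, the DFS
-- parent of b is not visited before a, since a cannot be finished while its neighbour t is unvisited.
-- Unless the parent is a itself, the chain of parents from b back to a passes through non-neighbours
-- of t, whose intervals all lie on one side of the interval of t; hence a and b both contain the
-- endpoint of t's interval on that side, and are adjacent.
-- (⇐) Given a hamiltonian path v₁ … v_k of G[N(t)], run a DFS visiting v₁, …, v_k in turn and t last.
-- On reaching vᵢ, it explores the far vertices (neither t nor adjacent to t) hanging off vᵢ, but
-- abandons any exploration that meets an unvisited neighbour of t: that part is explored later, from
-- some vⱼ with j > i.  Connectivity then forces every vertex to be visited before t.  This direction
-- uses no interval structure.
module Submission where

open import Defs
open import Data.Nat as ℕ using (ℕ; zero; suc; _+_; _≤_; _<_; z≤n; z<s; s<s)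
import Data.Nat.Properties as ℕ
open import Data.Fin using (Fin; zero; suc; toℕ; fromℕ; fromℕ<; punchOut) renaming (_<_ to _<ᶠ_)
open import Data.Fin.Properties
  using (any?; punchOut-injective; injective⇒≤; <-cmp; ≤fromℕ; toℕ<n; toℕ-injective; toℕ-fromℕ; toℕ-fromℕ<)
  renaming (_≟_ to _≟ᶠ_; <-irrefl to <ᶠ-irrefl)
open import Data.Fin.Induction using (<-wellFounded)
open import Data.Product using (Σ; ∃-syntax; Σ-syntax; _×_; _,_; proj₁; proj₂)
open import Data.Empty using (⊥-elim)
open import Data.Sum as Sum using (_⊎_; inj₁; inj₂)
open import Data.List using (List; []; _∷_; [_]; _++_; _∷ʳ_; length; tabulate; filter; allFin; reverse)
open import Data.List.Properties using (length-filter; length-tabulate; length-reverse; reverse-++; unfold-reverse; ++-assoc)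
open import Data.List.Membership.Propositional using (_∈_; _∉_)
open import Data.List.Membership.Propositional.Properties using (∈-filter⁺; ∈-filter⁻; ∈-tabulate⁺; ∈-allFin; ∈-++⁺ˡ; ∈-++⁺ʳ; ∈-++⁻)
open import Data.List.Membership.Propositional.Properties.WithK using (unique∧set⇒bag)
import Data.List.Membership.DecPropositional as DecMembership
open import Data.List.Relation.Binary.BagAndSetEquality using (∼bag⇒↭)
open import Data.List.Relation.Binary.Permutation.Propositional using (_↭_; ↭-sym; ↭-trans; ↭⇒↭ₛ)
import Data.List.Relation.Binary.Permutation.Setoid.Properties as PermutationSetoid
open import Data.List.Relation.Binary.Permutation.Propositional.Properties using (↭-length; ∈-resp-↭; shift; ++-comm; ↭-reverse)
open import Data.List.Relation.Binary.Subset.Propositional using (_⊆_)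
open import Data.List.Relation.Unary.All as All using (All; []; _∷_)
import Data.List.Relation.Unary.All.Properties as All
open import Data.List.Relation.Unary.AllPairs using ([]; _∷_)
open import Data.List.Relation.Unary.Any using (here; there)
import Data.List.Relation.Unary.Any.Properties as Any
open import Data.List.Relation.Unary.First as First using (First)
import Data.List.Relation.Unary.First.Properties as FirstProperties
open import Data.List.Relation.Unary.Unique.Propositional using (Unique)
open import Data.List.Relation.Unary.Linked using (Linked; []; [-]; _∷_)
open import Data.List.Relation.Unary.Unique.Propositional.Properties using (filter⁺; tabulate⁺; allFin⁺; Unique[x∷xs]⇒x∉xs)
open import Relation.Binary.PropositionalEquality
  using (_≡_; _≢_; refl; subst; trans; cong; cong₂; module ≡-Reasoning)
  renaming (sym to ≡-sym; setoid to ≡-setoid)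
open import Relation.Binary using (tri<; tri≈; tri>)
open import Relation.Binary.Definitions using (Decidable)
open import Relation.Nullary using (¬_; Dec; yes; no)
open import Relation.Nullary.Decidable using (¬?; _×-dec_; decidable-stable)
open import Relation.Binary.Construct.Closure.ReflexiveTransitive using (Star; ε; _◅_; _◅◅_)
open import Induction.WellFounded using (Acc; acc)
open import Function.Base using (_∘_; id; case_of_)
open import Function.Bundles using (_⇔_; mk⇔; Equivalence)
open import Function.Definitions using (Injective)

injective⇒surjective : ∀ {n} (f : Fin n → Fin n) → Injective _≡_ _≡_ f → ∀ v → ∃[ i ] f i ≡ v
injective⇒surjective {suc n} f f-injective v with any? (λ i → f i ≟ᶠ v)
... | yes hit = hit
... | no miss = ⊥-elim (ℕ.1+n≰n (injective⇒≤ squeezed-injective))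
  where
  missed : ∀ i → v ≢ f i
  missed i v≡fi = miss (i , ≡-sym v≡fi)
  squeezed-injective : Injective _≡_ _≡_ (λ i → punchOut (missed i))
  squeezed-injective {i} {j} eq = f-injective (punchOut-injective (missed i) (missed j) eq)

module _ {A : Set} {P : A → Set} (P? : ∀ x → Dec (P x)) (R : A → A → Set) where

  ConsecutiveRelated : ∀ {m} → (Fin m → A) → Set
  ConsecutiveRelated f = ∀ {i j} → i <ᶠ j → P (f i) → P (f j) →
    (∀ {k} → i <ᶠ k → k <ᶠ j → ¬ P (f k)) → R (f i) (f j)

  private
    consecutive-suc : ∀ {m} {f : Fin (suc m) → A} → ConsecutiveRelated f → ConsecutiveRelated (f ∘ suc)
    consecutive-suc rel i<j pi pj between =
      rel (s<s i<j) pi pj λ { {zero} () ; {suc k} (s<s i<k) (s<s k<j) → between i<k k<j }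

    zero-related : ∀ {m} {f : Fin (suc m) → A} → ConsecutiveRelated f → P (f zero) →
      ∀ {j} → P (f (suc j)) → (∀ {k} → k <ᶠ j → ¬ P (f (suc k))) → R (f zero) (f (suc j))
    zero-related rel p0 pj first = rel z<s p0 pj λ { {zero} () ; {suc k} _ (s<s k<j) → first k<j }

    cons-linked : ∀ {m} x (f : Fin m → A) →
      (∀ {j} → P (f j) → (∀ {k} → k <ᶠ j → ¬ P (f k)) → R x (f j)) →
      ConsecutiveRelated f → Linked R (x ∷ filter P? (tabulate f))
    cons-linked {zero} x f _ _ = [-]
    cons-linked {suc m} x f x-related rel with P? (f zero)
    ... | yes p = x-related p (λ ()) ∷
                  cons-linked (f zero) (f ∘ suc) (zero-related rel p) (consecutive-suc rel)
    ... | no ¬p = cons-linked x (f ∘ suc)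
                    (λ pj first → x-related pj λ { {zero} _ → ¬p ; {suc k} (s<s k<j) → first k<j })
                    (consecutive-suc rel)

  filter-tabulate-linked : ∀ {m} (f : Fin m → A) → ConsecutiveRelated f → Linked R (filter P? (tabulate f))
  filter-tabulate-linked {zero} f _ = []
  filter-tabulate-linked {suc m} f rel with P? (f zero)
  ... | yes p = cons-linked (f zero) (f ∘ suc) (zero-related rel p) (consecutive-suc rel)
  ... | no _  = filter-tabulate-linked (f ∘ suc) (consecutive-suc rel)

unique-length-≡ : ∀ {A : Set} {xs ys : List A} → Unique xs → Unique ys → (∀ {x} → x ∈ xs ⇔ x ∈ ys) →
  length xs ≡ length ys
unique-length-≡ xs! ys! same = ↭-length (∼bag⇒↭ (unique∧set⇒bag xs! ys! same))

unique-resp-↭ : ∀ {A : Set} {xs ys : List A} → xs ↭ ys → Unique xs → Unique ys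
unique-resp-↭ xs↭ys = PermutationSetoid.Unique-resp-↭ (≡-setoid _) (↭⇒↭ₛ xs↭ys)

module _ {n : ℕ} where

  open DecMembership (_≟ᶠ_ {n}) using (_∈?_)

  unique-length-≤ : {xs : List (Fin n)} → Unique xs → length xs ≤ n
  unique-length-≤ {xs} xs! = begin
    length xs                              ≡⟨ unique-length-≡ xs! (filter⁺ (_∈? xs) (allFin⁺ n)) same ⟩
    length (filter (_∈? xs) (allFin n))   ≤⟨ length-filter (_∈? xs) (allFin n) ⟩
    length (allFin n)                      ≡⟨ length-tabulate id ⟩
    n                                      ∎
    where
    open ℕ.≤-Reasoning
    same : ∀ {x} → x ∈ xs ⇔ x ∈ filter (_∈? xs) (allFin n)
    same {x} = mk⇔ (∈-filter⁺ (_∈? xs) (∈-allFin x)) (proj₂ ∘ ∈-filter⁻ (_∈? xs) {xs = allFin n})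

  unique-covering-length : {xs : List (Fin n)} → Unique xs → (∀ v → v ∈ xs) → length xs ≡ n
  unique-covering-length xs! covers =
    trans (unique-length-≡ xs! (allFin⁺ _) (mk⇔ (λ _ → ∈-allFin _) (λ _ → covers _))) (length-tabulate id)

<-length-∷ʳ : ∀ {A : Set} (ys : List A) {y i} → i < length (ys ∷ʳ y) → i < length ys ⊎ i ≡ length ys
<-length-∷ʳ []       {i = zero}  _ = inj₂ refl
<-length-∷ʳ []       {i = suc i} (s<s ())
<-length-∷ʳ (x ∷ ys) {i = zero}  _ = inj₁ z<s
<-length-∷ʳ (x ∷ ys) {i = suc i} (s<s i<n) = Sum.map s<s (cong suc) (<-length-∷ʳ ys i<n)

length-after : ∀ {A : Set} (xs : List A) {y ys} → length xs < length (xs ++ y ∷ ys)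
length-after []       = z<s
length-after (x ∷ xs) = s<s (length-after xs)

reverse-around : ∀ {A : Set} (xs : List A) y ys → reverse (xs ++ y ∷ ys) ≡ reverse ys ++ y ∷ reverse xs
reverse-around xs y ys = begin
  reverse (xs ++ y ∷ ys)          ≡⟨ reverse-++ xs (y ∷ ys) ⟩
  reverse (y ∷ ys) ++ reverse xs  ≡⟨ cong (_++ reverse xs) (unfold-reverse y ys) ⟩
  (reverse ys ∷ʳ y) ++ reverse xs ≡⟨ ++-assoc (reverse ys) [ y ] (reverse xs) ⟩
  reverse ys ++ y ∷ reverse xs    ∎
  where open ≡-Reasoning

module IntervalModel {n} (G : Graph n) (l r : Fin n → ℕ) (l≤r : ∀ v → l v ≤ r v)
  (model : ∀ u v → u ≢ v → (Adj G u v ⇔ (l u ≤ r v × l v ≤ r u))) where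

  open Equivalence

  Covers : Fin n → ℕ → Set
  Covers v q = l v ≤ q × q ≤ r v

  adjacent⇒≢ : ∀ {u v} → Adj G u v → u ≢ v
  adjacent⇒≢ a refl = irrefl G a

  adjacent⇒overlap : ∀ {u v} → Adj G u v → l u ≤ r v × l v ≤ r u
  adjacent⇒overlap {u} {v} a = to (model u v (adjacent⇒≢ a)) a

  common-point⇒adjacent : ∀ {u v q} → u ≢ v → Covers u q → Covers v q → Adj G u v
  common-point⇒adjacent {u} {v} u≢v (lu≤q , q≤ru) (lv≤q , q≤rv) =
    from (model u v u≢v) (ℕ.≤-trans lu≤q q≤rv , ℕ.≤-trans lv≤q q≤ru)

  adjacent? : Decidable (Adj G)
  adjacent? u v with u ≟ᶠ v
  ... | yes refl = no (irrefl G)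
  ... | no u≢v with l u ℕ.≤? r v | l v ℕ.≤? r u
  ...   | yes p | yes q = yes (from (model u v u≢v) (p , q))
  ...   | no ¬p | _     = no (¬p ∘ proj₁ ∘ adjacent⇒overlap)
  ...   | yes _ | no ¬q = no (¬q ∘ proj₂ ∘ adjacent⇒overlap)

  module _ (t : Fin n) where

    data Side : Set where
      left right : Side

    Beyond : Side → Fin n → Set
    Beyond left  x = r x ℕ.< l t
    Beyond right x = r t ℕ.< l x

    endpoint : Side → ℕ
    endpoint left  = l t
    endpoint right = r t

    nonadjacent⇒beyond : ∀ {x} → t ≢ x → ¬ Adj G t x → Σ Side λ s → Beyond s x
    nonadjacent⇒beyond {x} t≢x ¬tx with l t ℕ.≤? r x | l x ℕ.≤? r t
    ... | no ¬p | _     = left , ℕ.≰⇒> ¬p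
    ... | yes p | yes q = ⊥-elim (¬tx (from (model t x t≢x) (p , q)))
    ... | yes _ | no ¬q = right , ℕ.≰⇒> ¬q

    bridge-covers-endpoint : ∀ {s x u} → Beyond s x → Adj G u x → Adj G u t → Covers u (endpoint s)
    bridge-covers-endpoint {left}  bx ux ut =
      ℕ.≤-trans (proj₁ (adjacent⇒overlap ux)) (ℕ.<⇒≤ bx) , proj₂ (adjacent⇒overlap ut)
    bridge-covers-endpoint {right} bx ux ut =
      proj₁ (adjacent⇒overlap ut) , ℕ.≤-trans (ℕ.<⇒≤ bx) (proj₂ (adjacent⇒overlap ux))

    private
      opposite-sides-nonadjacent : ∀ {x y} → Beyond left x → Beyond right y → ¬ Adj G y x
      opposite-sides-nonadjacent {x} {y} bx by yx = ℕ.<⇒≱ (begin-strict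
        r x  <⟨ bx ⟩
        l t  ≤⟨ l≤r t ⟩
        r t  <⟨ by ⟩
        l y  ∎) (proj₁ (adjacent⇒overlap yx))
        where open ℕ.≤-Reasoning

    beyond-closed : ∀ {s x y} → Beyond s x → Adj G y x → t ≢ y → ¬ Adj G t y → Beyond s y
    beyond-closed {s} bx yx t≢y ¬ty with s | nonadjacent⇒beyond t≢y ¬ty
    ... | left  | left  , by = by
    ... | right | right , by = by
    ... | left  | right , by = ⊥-elim (opposite-sides-nonadjacent bx by yx)
    ... | right | left  , by = ⊥-elim (opposite-sides-nonadjacent by bx (Graph.sym G yx))

module LastVertexOfDFS {n} (G : Graph (suc n)) (l r : Fin (suc n) → ℕ) (l≤r : ∀ v → l v ≤ r v)
  (model : ∀ u v → u ≢ v → (Adj G u v ⇔ (l u ≤ r v × l v ≤ r u)))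
  (σ : Fin (suc n) → Fin (suc n)) (dfs : IsDFSOrdering G σ) where

  open IntervalModel G l r l≤r model

  t : Fin (suc n)
  t = σ (fromℕ n)

  σ-injective : Injective _≡_ _≡_ σ
  σ-injective = proj₁ dfs

  ParentOf : Fin (suc n) → Fin (suc n) → Set
  ParentOf c j = j <ᶠ c × Adj G (σ j) (σ c) ×
    (∀ k → j <ᶠ k → k <ᶠ c → ∀ w → Adj G (σ k) w → VisitedBefore σ c w)

  parent : ∀ {a c} → a <ᶠ c → Σ[ j ∈ Fin (suc n) ] ParentOf c j
  parent {a} {c} a<c = proj₂ dfs c (a , a<c)

  ≢last : ∀ {j c : Fin (suc n)} → j <ᶠ c → t ≢ σ j
  ≢last {j} {c} j<c t≡σj with σ-injective t≡σj
  ... | refl = ℕ.<⇒≱ j<c (≤fromℕ c)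

  last-unvisited : ∀ c → ¬ VisitedBefore σ c t
  last-unvisited c (m , m<c , σm≡t) = ≢last m<c (≡-sym σm≡t)

  neighbour-parent-not-before : ∀ {a c j} → Adj G t (σ a) → a <ᶠ c → ParentOf c j → ¬ j <ᶠ a
  neighbour-parent-not-before {a} {c} ta a<c (_ , _ , finished) j<a =
    last-unvisited c (finished a j<a a<c t (Graph.sym G ta))

  module Gap {a b : Fin (suc n)} (ta : Adj G t (σ a)) (a<b : a <ᶠ b)
    (gap : ∀ {k} → a <ᶠ k → k <ᶠ b → ¬ Adj G t (σ k)) where

    covers-endpoint : ∀ {s} c → Acc _<ᶠ_ c → a <ᶠ c → c <ᶠ b → Beyond t s (σ c) → Covers (σ a) (endpoint t s)
    covers-endpoint c (acc rec) a<c c<b bc with parent a<c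
    ... | j , p@(j<c , jc , _) with <-cmp j a
    ... | tri< j<a _ _ = ⊥-elim (neighbour-parent-not-before ta a<c p j<a)
    ... | tri≈ _ refl _ = bridge-covers-endpoint t bc jc (Graph.sym G ta)
    ... | tri> _ _ a<j = covers-endpoint j (rec j<c) a<j j<b
                           (beyond-closed t bc jc (≢last j<b) (gap a<j j<b))
      where j<b = ℕ.<-trans j<c c<b

    consecutive-adjacent : Adj G t (σ b) → Adj G (σ a) (σ b)
    consecutive-adjacent tb with parent a<b
    ... | j , p@(j<b , jb , _) with <-cmp j a
    ... | tri< j<a _ _ = ⊥-elim (neighbour-parent-not-before ta a<b p j<a)
    ... | tri≈ _ refl _ = jb
    ... | tri> _ _ a<j with nonadjacent⇒beyond t (≢last j<b) (gap a<j j<b)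
    ...   | s , bj = common-point⇒adjacent σa≢σb
                       (covers-endpoint j (<-wellFounded j) a<j j<b bj)
                       (bridge-covers-endpoint t bj (Graph.sym G jb) (Graph.sym G tb))
      where
      σa≢σb : σ a ≢ σ b
      σa≢σb eq = <ᶠ-irrefl (σ-injective eq) a<b

  neighbourhood-path : HasHamPathInNbhd G t
  neighbourhood-path =
    path , filter⁺ (adjacent? t) (tabulate⁺ σ-injective) , (λ v → mk⇔ (on-path v) (neighbour-on-path v)) ,
    filter-tabulate-linked (adjacent? t) (Adj G) σ
      (λ i<j ti tj gap → Gap.consecutive-adjacent ti i<j gap tj)
    where
    path : List (Fin (suc n))
    path = filter (adjacent? t) (tabulate σ)
    on-path : ∀ v → v ∈ path → Adj G t v
    on-path v = proj₂ ∘ ∈-filter⁻ (adjacent? t)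
    neighbour-on-path : ∀ v → Adj G t v → v ∈ path
    neighbour-on-path v tv with injective⇒surjective σ σ-injective v
    ... | i , refl = ∈-filter⁺ (adjacent? t) (∈-tabulate⁺ {f = σ} i) tv

module DFSHistories {n} (G : Graph (suc n)) where

  V : Set
  V = Fin (suc n)

  Finished : List V → V → Set
  Finished xs u = ∀ {w} → Adj G u w → w ∈ xs

  finished-⊆ : ∀ {xs ys u} → xs ⊆ ys → Finished xs u → Finished ys u
  finished-⊆ xs⊆ys u-finished uw = xs⊆ys (u-finished uw)

  Parent : List V → V → Set
  Parent xs v = First (Finished xs) (λ u → Adj G u v) xs

  -- Histories list the visited vertices most recent first.
  data DFSHistory : List V → Set where
    start : ∀ v → DFSHistory [ v ]
    visit : ∀ {xs v} → DFSHistory xs → v ∉ xs → Parent xs v → DFSHistory (v ∷ xs)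

  history-unique : ∀ {xs} → DFSHistory xs → Unique xs
  history-unique (start v)        = [] ∷ []
  history-unique (visit h v∉xs _) = All.¬Any⇒All¬ _ v∉xs ∷ history-unique h

  -- Out-of-range positions read as the vertex zero; only positions below the length are used.
  at : List V → ℕ → V
  at []       _       = zero
  at (x ∷ xs) zero    = x
  at (x ∷ xs) (suc i) = at xs i

  at-++ˡ : ∀ xs {ys i} → i < length xs → at (xs ++ ys) i ≡ at xs i
  at-++ˡ (x ∷ xs) {i = zero}  _         = refl
  at-++ˡ (x ∷ xs) {i = suc i} (s<s i<n) = at-++ˡ xs i<n

  at-length : ∀ xs {y ys} → at (xs ++ y ∷ ys) (length xs) ≡ y
  at-length []       = refl
  at-length (x ∷ xs) = at-length xs

  at-∈ : ∀ xs {i} → i < length xs → at xs i ∈ xs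
  at-∈ (x ∷ xs) {zero}  _         = here refl
  at-∈ (x ∷ xs) {suc i} (s<s i<n) = there (at-∈ xs i<n)

  at-after : ∀ xs {y ys k} → length xs < k → k < length (xs ++ y ∷ ys) → at (xs ++ y ∷ ys) k ∈ ys
  at-after []       {ys = ys} {suc k} _           (s<s k<n) = at-∈ ys k<n
  at-after (x ∷ xs) {k = suc k} (s<s xs<k) (s<s k<n) = at-after xs xs<k k<n

  ∈⇒at : ∀ {w xs} → w ∈ xs → ∃[ m ] (m < length xs × at xs m ≡ w)
  ∈⇒at (here refl) = zero , z<s , refl
  ∈⇒at (there w∈xs) with ∈⇒at w∈xs
  ... | m , m<n , eq = suc m , s<s m<n , eq

  at-injective : ∀ {xs i j} → Unique xs → i < length xs → j < length xs → at xs i ≡ at xs j → i ≡ j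
  at-injective {x ∷ xs} {zero}  {zero}  _           _         _         _  = refl
  at-injective {x ∷ xs} {zero}  {suc j} (x∉ ∷ _)    _         (s<s j<n) eq = ⊥-elim (All.lookup x∉ (at-∈ xs j<n) eq)
  at-injective {x ∷ xs} {suc i} {zero}  (x∉ ∷ _)    (s<s i<n) _         eq = ⊥-elim (All.lookup x∉ (at-∈ xs i<n) (≡-sym eq))
  at-injective {x ∷ xs} {suc i} {suc j} (_ ∷ xs!)   (s<s i<n) (s<s j<n) eq = cong suc (at-injective xs! i<n j<n eq)

  SeenBefore : List V → ℕ → V → Set
  SeenBefore ys i w = ∃[ m ] (m < i × at ys m ≡ w)

  ParentAt : List V → ℕ → V → Set
  ParentAt ys i v = ∃[ j ] (j < i × Adj G (at ys j) v ×
    (∀ {k} → j < k → k < i → ∀ {w} → Adj G (at ys k) w → SeenBefore ys i w))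

  ChronologicalDFS : List V → Set
  ChronologicalDFS ys = ∀ {i} → i < length ys → 0 < i → ParentAt ys i (at ys i)

  parentAt-++ : ∀ ys {zs i v} → i ≤ length ys → ParentAt ys i v → ParentAt (ys ++ zs) i v
  parentAt-++ ys {v = v} i≤n (j , j<i , jv , finished) =
    j , j<i , subst (λ u → Adj G u v) (≡-sym (at-++ˡ ys (ℕ.<-≤-trans j<i i≤n))) jv ,
    λ j<k k<i kw → seen (finished j<k k<i (subst (λ u → Adj G u _) (at-++ˡ ys (ℕ.<-≤-trans k<i i≤n)) kw))
    where
    seen : ∀ {w} → SeenBefore ys _ w → SeenBefore (ys ++ _) _ w
    seen (m , m<i , eq) = m , m<i , trans (at-++ˡ ys (ℕ.<-≤-trans m<i i≤n)) eq

  snoc-chronological : ∀ {ys v} → ChronologicalDFS ys → ParentAt ys (length ys) v → ChronologicalDFS (ys ∷ʳ v)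
  snoc-chronological {ys} {v} chrono parent {i} i<n 0<i with <-length-∷ʳ ys i<n
  ... | inj₁ i<ys =
    subst (ParentAt (ys ∷ʳ v) i) (≡-sym (at-++ˡ ys i<ys)) (parentAt-++ ys (ℕ.<⇒≤ i<ys) (chrono i<ys 0<i))
  ... | inj₂ refl = subst (ParentAt (ys ∷ʳ v) i) (≡-sym (at-length ys)) (parentAt-++ ys ℕ.≤-refl parent)

  parentAt-around : ∀ older u recent {v} → Adj G u v →
    (∀ {x} → x ∈ recent → Finished (older ++ u ∷ recent) x) →
    ParentAt (older ++ u ∷ recent) (length (older ++ u ∷ recent)) v
  parentAt-around older u recent {v} uv recent-finished =
    length older , length-after older , subst (λ x → Adj G x v) (≡-sym (at-length older)) uv ,
    λ older<k k<n kw → ∈⇒at (recent-finished (at-after older older<k k<n) kw)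

  parent-position : ∀ {xs v} → Parent xs v → ParentAt (reverse xs) (length (reverse xs)) v
  parent-position {v = v} par with FirstProperties.toView par
  ... | First._++_∷_ {recent} {u} recent-finished uv older =
    subst (λ ys → ParentAt ys (length ys) v) (≡-sym around)
      (parentAt-around (reverse older) u (reverse recent) uv
        λ x∈ xw → subst (_ ∈_) around (Any.reverse⁺ (All.lookup recent-finished (Any.reverse⁻ x∈) xw)))
    where
    around : reverse (recent ++ u ∷ older) ≡ reverse older ++ u ∷ reverse recent
    around = reverse-around recent u older

  history-chronological : ∀ {xs} → DFSHistory xs → ChronologicalDFS (reverse xs)
  history-chronological (start v) {zero}  _         ()
  history-chronological (start v) {suc i} (s<s ()) _
  history-chronological (visit {xs} {v} h _ par) =
    subst ChronologicalDFS (≡-sym (unfold-reverse v xs))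
      (snoc-chronological {reverse xs} (history-chronological h) (parent-position par))

  chronological⇒end-vertex : ∀ {ys t} → ChronologicalDFS ys → Unique ys → length ys ≡ suc n → at ys n ≡ t →
    IsDFSEndVertex G t
  chronological⇒end-vertex {ys} {t} chrono ys! len last =
    σ , (σ-injective , σ-dfs) , trans (cong (at ys) (toℕ-fromℕ n)) last
    where
    σ : V → V
    σ i = at ys (toℕ i)
    in-range : ∀ i → toℕ i < length ys
    in-range i = subst (toℕ i <_) (≡-sym len) (toℕ<n i)
    σ-injective : Injective _≡_ _≡_ σ
    σ-injective eq = toℕ-injective (at-injective ys! (in-range _) (in-range _) eq)
    position : ∀ {m} → m < suc n → Σ[ i ∈ V ] toℕ i ≡ m
    position m<n = fromℕ< m<n , toℕ-fromℕ< m<n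
    σ-dfs : ∀ i → Σ[ m ∈ V ] (m <ᶠ i) → Σ[ j ∈ V ] (j <ᶠ i × Adj G (σ j) (σ i) ×
              (∀ k → j <ᶠ k → k <ᶠ i → ∀ w → Adj G (σ k) w → VisitedBefore σ i w))
    σ-dfs i (m , m<i) with chrono (in-range i) (ℕ.≤-<-trans z≤n m<i)
    ... | j , j<i , ji , finished with position (ℕ.<-trans j<i (toℕ<n i))
    ... | j′ , refl = j′ , j<i , ji , λ k j<k k<i w kw → seen (finished j<k k<i kw)
      where
      seen : ∀ {w} → SeenBefore ys (toℕ i) w → VisitedBefore σ i w
      seen (m , m<i , eq) with position (ℕ.<-trans m<i (toℕ<n i))
      ... | m′ , refl = m′ , m<i , eq

  covering-history⇒end-vertex : ∀ {t L} → DFSHistory (t ∷ L) → (∀ w → w ∈ t ∷ L) → IsDFSEndVertex G t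
  covering-history⇒end-vertex {t} {L} history covering =
    chronological⇒end-vertex (history-chronological history)
      (unique-resp-↭ (↭-sym (↭-reverse (t ∷ L))) history!) (trans (length-reverse (t ∷ L)) length≡) last
    where
    history! : Unique (t ∷ L)
    history! = history-unique history
    length≡ : length (t ∷ L) ≡ suc n
    length≡ = unique-covering-length history! covering
    last : at (reverse (t ∷ L)) n ≡ t
    last = begin
      at (reverse (t ∷ L)) n                       ≡⟨ cong₂ at (unfold-reverse t L)
                                                        (≡-sym (trans (length-reverse L) (ℕ.suc-injective length≡))) ⟩
      at (reverse L ++ [ t ]) (length (reverse L)) ≡⟨ at-length (reverse L) ⟩
      t                                            ∎
      where open ≡-Reasoning

module DFSEndingAt {n} (G : Graph (suc n)) (adjacent? : Decidable (Adj G)) (t : Fin (suc n)) where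

  open DFSHistories G
  open DecMembership (_≟ᶠ_ {suc n}) using (_∈?_)
  open Equivalence

  Far : V → Set
  Far w = ¬ Adj G t w × t ≢ w

  far? : ∀ w → Dec (Far w)
  far? w = ¬? (adjacent? t w) ×-dec ¬? (t ≟ᶠ w)

  near⇒¬far : ∀ {w} → Adj G t w → ¬ Far w
  near⇒¬far tw (¬tw , _) = ¬tw tw

  FarStep : V → V → Set
  FarStep u w = Adj G u w × Far w

  Unfinished : List V → V → Set
  Unfinished xs u = ∃[ w ] (Adj G u w × w ∉ xs)

  finished? : ∀ xs u → Finished xs u ⊎ Unfinished xs u
  finished? xs u with any? (λ w → adjacent? u w ×-dec ¬? (w ∈? xs))
  ... | yes unfinished = inj₂ unfinished
  ... | no none = inj₁ λ {w} uw → decidable-stable (w ∈? xs) (λ w∉xs → none (w , uw , w∉xs))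

  data Exploration (xs : List V) (y : V) : Set where
    blocked  : ∀ {z w} → Far z → Star FarStep y z → Adj G z w → Adj G t w → w ∉ xs → Exploration xs y
    explored : ∀ new → DFSHistory (new ++ xs) → All (λ z → Far z × Finished (new ++ xs) z) new → y ∈ new →
               Exploration xs y

  far-neighbour-of-far : ∀ {z w} → Far z → Adj G z w → ¬ Far w → Adj G t w
  far-neighbour-of-far {z} {w} (¬tz , _) zw ¬far-w with adjacent? t w | t ≟ᶠ w
  ... | yes tw | _        = tw
  ... | no ¬tw | yes refl = ⊥-elim (¬tz (Graph.sym G zw))
  ... | no ¬tw | no t≢w   = ⊥-elim (¬far-w (¬tw , t≢w))

  explore : ∀ {xs y} fuel new → suc n ≤ fuel + length (new ++ xs) → DFSHistory (new ++ xs) →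
    All (λ z → Far z × Star FarStep y z) new → y ∈ new → Exploration xs y
  explore {xs} {y} fuel new bound h reached y∈new with First.first (finished? (new ++ xs)) new
  ... | inj₂ all-finished =
    explored new h (All.zipWith (λ ((far , _) , finished) → far , finished) (reached , all-finished)) y∈new
  ... | inj₁ unfinished with FirstProperties.toView unfinished
  ... | First._++_∷_ {recent} {z} recent-finished (w , zw , w∉) older
    with All.lookup reached (∈-++⁺ʳ recent (here refl)) | far? w
  ...   | far-z , y⇝z | no ¬far-w =
    blocked far-z y⇝z zw (far-neighbour-of-far far-z zw ¬far-w) (w∉ ∘ ∈-++⁺ʳ new)
  ...   | far-z , y⇝z | yes far-w = continue fuel bound
    where
    h′ : DFSHistory (w ∷ new ++ xs)
    h′ = visit h w∉ (FirstProperties.⁺++ (FirstProperties.++⁺ recent-finished First.[ zw ]) xs)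
    continue : ∀ fuel → suc n ≤ fuel + length (new ++ xs) → Exploration xs y
    continue zero      bound = ⊥-elim (ℕ.<⇒≱ (unique-length-≤ (history-unique h′)) bound)
    continue (suc fuel) bound =
      explore fuel (w ∷ new) (subst (suc n ≤_) (≡-sym (ℕ.+-suc fuel _)) bound) h′
        ((far-w , y⇝z ◅◅ ((zw , far-w) ◅ ε)) ∷ reached) (there y∈new)

  back-propagate : ∀ {F y z} → (∀ {w} → Far w → w ∈ F → Finished F w) → Star FarStep y z → z ∈ F → y ∈ F
  back-propagate far-finished ε z∈F = z∈F
  back-propagate far-finished ((yb , far-b) ◅ b⇝z) z∈F =
    far-finished far-b (back-propagate far-finished b⇝z z∈F) (Graph.sym G yb)

  -- The state after visiting the path vertex v, the path vertices visited so far being v ∷ earlier.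
  record Stage (v : V) (earlier xs : List V) : Set where
    field
      history        : DFSHistory xs
      above below    : List V
      split          : xs ≡ above ++ v ∷ below
      above-finished : All (Finished xs) above
      far-finished   : ∀ {w} → Far w → w ∈ xs → Finished xs w
      near-visited   : ∀ {w} → ¬ Far w → w ∈ xs ⇔ w ∈ v ∷ earlier

    parent : ∀ {u} → Adj G v u → Parent xs u
    parent vu = subst (First (Finished xs) (λ x → Adj G x _)) (≡-sym split)
                  (FirstProperties.++⁺ above-finished First.[ vu ])

  initial-stage : ∀ {v} → Adj G t v → Stage v [] [ v ]
  initial-stage tv = record
    { history        = start _
    ; above          = []
    ; below          = []
    ; split          = refl
    ; above-finished = []
    ; far-finished   = λ { far (here refl) → ⊥-elim (near⇒¬far tv far) }
    ; near-visited   = λ _ → mk⇔ id id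
    }

  explored-stage : ∀ {v earlier xs} new → Stage v earlier xs → DFSHistory (new ++ xs) →
    All (λ z → Far z × Finished (new ++ xs) z) new → Stage v earlier (new ++ xs)
  explored-stage {v} {earlier} {xs} new st h new-done = record
    { history        = h
    ; above          = new ++ above
    ; below          = below
    ; split          = trans (cong (new ++_) split) (≡-sym (++-assoc new above _))
    ; above-finished = All.++⁺ (All.map proj₂ new-done) (All.map (finished-⊆ (∈-++⁺ʳ new)) above-finished)
    ; far-finished   = far-finished′
    ; near-visited   = λ ¬far → mk⇔ (to (near-visited ¬far) ∘ old ¬far) (∈-++⁺ʳ new ∘ from (near-visited ¬far))
    }
    where
    open Stage st
    far-finished′ : ∀ {w} → Far w → w ∈ new ++ xs → Finished (new ++ xs) w
    far-finished′ far w∈ with ∈-++⁻ new w∈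
    ... | inj₁ w∈new = proj₂ (All.lookup new-done w∈new)
    ... | inj₂ w∈xs  = finished-⊆ (∈-++⁺ʳ new) (far-finished far w∈xs)
    old : ∀ {w} → ¬ Far w → w ∈ new ++ xs → w ∈ xs
    old ¬far w∈ with ∈-++⁻ new w∈
    ... | inj₁ w∈new = ⊥-elim (¬far (proj₁ (All.lookup new-done w∈new)))
    ... | inj₂ w∈xs  = w∈xs

  Blocked : List V → V → Set
  Blocked seen y = ∃[ z ] ∃[ w ] (Far z × Star FarStep y z × Adj G z w × Adj G t w × w ∉ seen)

  Handled : V → List V → List V → V → Set
  Handled v earlier xs y = Far y → Adj G v y → y ∈ xs ⊎ Blocked (v ∷ earlier) y

  handle : ∀ {v earlier xs} y → Stage v earlier xs →
    Σ[ xs′ ∈ List V ] (Stage v earlier xs′ × xs ⊆ xs′ × Handled v earlier xs′ y)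
  handle {v} {earlier} {xs} y st with y ∈? xs
  ... | yes y∈xs = xs , st , id , λ _ _ → inj₁ y∈xs
  ... | no y∉xs with far? y ×-dec adjacent? v y
  ...   | no ¬candidate = xs , st , id , λ far vy → ⊥-elim (¬candidate (far , vy))
  ...   | yes (far , vy)
    with explore (suc n) [ y ] (ℕ.m≤m+n (suc n) _) (visit (Stage.history st) y∉xs (Stage.parent st vy))
                 ((far , ε) ∷ []) (here refl)
  ...     | blocked far-z y⇝z zw tw w∉xs =
    xs , st , id ,
    λ _ _ → inj₂ (_ , _ , far-z , y⇝z , zw , tw , w∉xs ∘ from (Stage.near-visited st (near⇒¬far tw)))
  ...     | explored new h new-done y∈new =
    new ++ xs , explored-stage new st h new-done , ∈-++⁺ʳ new , λ _ _ → inj₁ (∈-++⁺ˡ y∈new)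

  handle-all : ∀ {v earlier xs} ys → Stage v earlier xs →
    Σ[ xs′ ∈ List V ] (Stage v earlier xs′ × xs ⊆ xs′ × ∀ {y} → y ∈ ys → Handled v earlier xs′ y)
  handle-all []       st = _ , st , id , λ ()
  handle-all (y ∷ ys) st with handle y st
  ... | xs₁ , st₁ , xs⊆xs₁ , handled₁ with handle-all ys st₁
  ... | xs₂ , st₂ , xs₁⊆xs₂ , handled₂ = xs₂ , st₂ , xs₁⊆xs₂ ∘ xs⊆xs₁ , λ
    { (here refl) far vy → Sum.map₁ xs₁⊆xs₂ (handled₁ far vy)
    ; (there y∈)         → handled₂ y∈ }

  NoUnvisitedFar : List V → V → Set
  NoUnvisitedFar xs u = ∀ {y} → Far y → Adj G u y → y ∈ xs

  record Complete (L : List V) : Set where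
    field
      history      : DFSHistory (t ∷ L)
      far-finished : ∀ {w} → Far w → w ∈ t ∷ L → Finished (t ∷ L) w
      near-visited : ∀ {w} → Adj G t w → w ∈ L

  complete⇒covering : ∀ {L} → Complete L → (∀ {u} → Adj G t u → NoUnvisitedFar (t ∷ L) u) → Connected G →
    ∀ w → w ∈ t ∷ L
  complete⇒covering {L} complete near-done connected w = reach (connected w t)
    where
    open Complete complete
    reach : ∀ {a} → Star (Adj G) a t → a ∈ t ∷ L
    reach ε = here refl
    reach {a} (_◅_ {j = b} ab b⇝t) with t ≟ᶠ a | adjacent? t a
    ... | yes refl | _      = here refl
    ... | no _     | yes ta = there (near-visited ta)
    ... | no t≢a   | no ¬ta with adjacent? t b | t ≟ᶠ b
    ...   | yes tb | _        = near-done tb (¬ta , t≢a) (Graph.sym G ab)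
    ...   | no _   | yes refl = ⊥-elim (¬ta (Graph.sym G ab))
    ...   | no ¬tb | no t≢b   = far-finished (¬tb , t≢b) (reach b⇝t) (Graph.sym G ab)

  module AlongPath (path : List V) (path! : Unique path) (on-path : ∀ v → v ∈ path ⇔ Adj G t v) where

    in-path : ∀ todo {seen w} → todo ++ seen ↭ path → w ∈ todo ++ seen ⇔ Adj G t w
    in-path _ {w = w} perm = mk⇔ (to (on-path w) ∘ ∈-resp-↭ perm) (∈-resp-↭ (↭-sym perm) ∘ from (on-path w))

    -- A blocked far neighbour y of v reaches, through far vertices, a far neighbour of a later path
    -- vertex w; that one is visited once w is done, and as visited far vertices are finished, the
    -- visit propagates back to y.
    handled⇒no-unvisited-far : ∀ {v earlier xs F} todo → todo ++ v ∷ earlier ↭ path →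
      (∀ {y} → Handled v earlier xs y) → xs ⊆ F → (∀ {w} → Far w → w ∈ F → Finished F w) →
      (∀ {u} → u ∈ todo → NoUnvisitedFar F u) → NoUnvisitedFar F v
    handled⇒no-unvisited-far todo perm handled xs⊆F far-finished later-done far-y vy with handled far-y vy
    ... | inj₁ y∈xs = xs⊆F y∈xs
    ... | inj₂ (z , w , far-z , y⇝z , zw , tw , w∉seen) with ∈-++⁻ todo (from (in-path todo perm) tw)
    ...   | inj₁ w∈todo = back-propagate far-finished y⇝z (later-done w∈todo far-z (Graph.sym G zw))
    ...   | inj₂ w∈seen = ⊥-elim (w∉seen w∈seen)

    finish : ∀ {v earlier xs} → [] ++ v ∷ earlier ↭ path → Stage v earlier xs → Complete xs
    finish {v} {earlier} {xs} perm st = record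
      { history      = visit history t∉xs (parent (Graph.sym G (to (in-path [] perm) (here refl))))
      ; far-finished = λ { (_ , t≢t) (here refl) → ⊥-elim (t≢t refl)
                         ; far (there w∈xs) → finished-⊆ there (far-finished far w∈xs) }
      ; near-visited = λ tw → from (near-visited (near⇒¬far tw)) (from (in-path [] perm) tw)
      }
      where
      open Stage st
      t∉xs : t ∉ xs
      t∉xs t∈xs = irrefl G (to (in-path [] perm) (to (near-visited (λ (_ , t≢t) → t≢t refl)) t∈xs))

    advance : ∀ {v earlier xs v₂} rest → (v₂ ∷ rest) ++ v ∷ earlier ↭ path → Adj G v v₂ → Stage v earlier xs →
      Stage v₂ (v ∷ earlier) (v₂ ∷ xs)
    advance {v} {earlier} {xs} {v₂} rest perm vv₂ st = record
      { history        = visit history v₂∉xs (parent vv₂)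
      ; above          = []
      ; below          = xs
      ; split          = refl
      ; above-finished = []
      ; far-finished   = λ { far (here refl) → ⊥-elim (near⇒¬far tv₂ far)
                           ; far (there w∈xs) → finished-⊆ there (far-finished far w∈xs) }
      ; near-visited   = λ ¬far → mk⇔ (λ { (here eq) → here eq ; (there w∈) → there (to (near-visited ¬far) w∈) })
                                         (λ { (here eq) → here eq ; (there w∈) → there (from (near-visited ¬far) w∈) })
      }
      where
      open Stage st
      tv₂ : Adj G t v₂
      tv₂ = to (in-path (v₂ ∷ rest) perm) (here refl)
      v₂∉xs : v₂ ∉ xs
      v₂∉xs v₂∈xs = Unique[x∷xs]⇒x∉xs (unique-resp-↭ (↭-sym perm) path!)
                      (∈-++⁺ʳ rest (to (near-visited (near⇒¬far tv₂)) v₂∈xs))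

    process : ∀ {v earlier xs} todo → todo ++ v ∷ earlier ↭ path → Linked (Adj G) (v ∷ todo) → Stage v earlier xs →
      Σ[ L ∈ List V ] (Complete L × xs ⊆ L × ∀ {u} → u ∈ v ∷ todo → NoUnvisitedFar (t ∷ L) u)
    process [] perm _ st with handle-all (allFin _) st
    ... | xs′ , st′ , xs⊆xs′ , handled = xs′ , complete , xs⊆xs′ , λ
      { (here refl) → handled⇒no-unvisited-far [] perm (handled (∈-allFin _)) there
                        (Complete.far-finished complete) (λ ()) }
      where complete = finish perm st′
    process (v₂ ∷ rest) perm (vv₂ ∷ linked) st with handle-all (allFin _) st
    ... | xs′ , st′ , xs⊆xs′ , handled
      with process rest (↭-trans (shift v₂ rest _) perm) linked (advance rest perm vv₂ st′)
    ... | L , complete , xs₂⊆L , later-done = L , complete , xs₂⊆L ∘ there ∘ xs⊆xs′ , λ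
      { (here refl) → handled⇒no-unvisited-far (v₂ ∷ rest) perm (handled (∈-allFin _)) (there ∘ xs₂⊆L ∘ there)
                        (Complete.far-finished complete) later-done
      ; (there u∈) → later-done u∈ }

  ham-path⇒complete : ∀ path → Unique path → (∀ v → v ∈ path ⇔ Adj G t v) → Linked (Adj G) path →
    Σ[ L ∈ List V ] (Complete L × ∀ {u} → Adj G t u → NoUnvisitedFar (t ∷ L) u)
  ham-path⇒complete [] _ on-path _ = [] , complete , λ tu → case from (on-path _) tu of λ ()
    where
    complete : Complete []
    complete = record
      { history      = start t
      ; far-finished = λ { (_ , t≢t) (here refl) → ⊥-elim (t≢t refl) }
      ; near-visited = λ tw → from (on-path _) tw
      }
  ham-path⇒complete (v ∷ todo) path! on-path linked
    with AlongPath.process (v ∷ todo) path! on-path todo (++-comm todo [ v ]) linked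
           (initial-stage (to (on-path v) (here refl)))
  ... | L , complete , _ , path-done = L , complete , λ tu → path-done (from (on-path _) tu)

  end-vertex : HasHamPathInNbhd G t → Connected G → IsDFSEndVertex G t
  end-vertex (path , path! , on-path , linked) connected with ham-path⇒complete path path! on-path linked
  ... | L , complete , near-done =
    covering-history⇒end-vertex (Complete.history complete) (complete⇒covering complete near-done connected)

theorem22 : (n : ℕ) (G : Graph (suc n)) → Connected G → IsIntervalGraph G →
    (t : Fin (suc n)) → (IsDFSEndVertex G t ⇔ HasHamPathInNbhd G t)
theorem22 n G connected (l , r , l≤r , model) t = mk⇔ end⇒path path⇒end
  where
  end⇒path : IsDFSEndVertex G t → HasHamPathInNbhd G t
  end⇒path (σ , dfs , refl) = LastVertexOfDFS.neighbourhood-path G l r l≤r model σ dfs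
  path⇒end : HasHamPathInNbhd G t → IsDFSEndVertex G t
  path⇒end ham = DFSEndingAt.end-vertex G (IntervalModel.adjacent? G l r l≤r model) t ham connected
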